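{- Define $a(1)=1$ and $a(n)=1+\sum_m a(m)$ for $n>1$, the sum over all proper divisors $m$ of $n$ (positive divisors $m<n$). Let $p,q,r$ be distinct primes and $c,d,e$ positive integers. Then $$a(p^c)=2a(p^{c-1}),$$ $$a(p^cq^d)=2\big(a(p^{c-1}q^d)+a(p^cq^{d-1})-a(p^{c-1}q^{d-1})\big),$$ $$a(p^cq^dr^e)=2\big(a(p^{c-1}q^dr^e)+a(p^cq^{d-1}r^e)+a(p^cq^dr^{e-1})-a(p^cq^{d-1}r^{e-1})-a(p^{c-1}q^dr^{e-1})-a(p^{c-1}q^{d-1}r^e)+a(p^{c-1}q^{d-1}r^{e-1})\big).$$
   Context: $a(n)$ is called the number of recursive divisors of $n$. -}

module Defs where

open import Data.Nat using (ℕ; zero; suc; _+_; _≤?_)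
open import Data.Nat.Divisibility using (_∣?_)
open import Data.List using (List; map; filter)
open import Data.Nat.ListAction using (sum)
open import Data.List.Base using (upTo)
open import Relation.Nullary using (yes; no)

properDivisors : ℕ → List ℕ
properDivisors n = filter (λ m → m ∣? n) (filter (λ m → 1 ≤? m) (upTo n))

-- a with fuel; the fuel f suffices whenever n ≤ f + 1 (proper divisors of n are < n)
aFuel : ℕ → ℕ → ℕ
aFuel zero    n = 1
aFuel (suc f) n with n ≤? 1
... | yes _ = 1
... | no  _ = 1 + sum (map (aFuel f) (properDivisors n))

a : ℕ → ℕ
a n = aFuel n n

-- Write D(k) for the sum of a(m) over all divisors m of k, so that the definition of a reads
-- D(k) = 2 a(k) - 1.  For n = p^c q^d r^e the proper divisors of n are exactly the divisors of
-- n/p, n/q or n/r, and, the primes being coprime, the common divisors of n/p and n/q are those of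
-- n/pq, and so on.  Counting every divisor m < n by inclusion-exclusion gives
--   a(n) - 1 = D(n/p) + D(n/q) + D(n/r) - D(n/pq) - D(n/pr) - D(n/qr) + D(n/pqr),
-- and substituting D = 2a - 1 leaves the stated recurrence; one or two primes work the same way.
module Submission where

open import Defs
open import Data.Bool.Base using (Bool; true; false; _∧_; _∨_)
open import Data.List.Base using (List; []; _∷_; _∷ʳ_; _++_; [_]; map; filter; upTo; length)
open import Data.List.Relation.Unary.All using (All; []; _∷_)
open import Data.Nat.Base using (ℕ; zero; suc; _^_; _∸_; NonZero) renaming (_*_ to _·_)
open import Data.Nat.ListAction using (sum)
open import Data.Nat.Primality using (Prime)
open import Data.Product.Base using (_×_; _,_; ∃-syntax)
open import Data.Sum.Base using (_⊎_; inj₁; inj₂; [_,_]′)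
open import Function.Base using (_∘_)
open import Relation.Binary.PropositionalEquality
  using (_≡_; _≢_; refl; sym; trans; cong; cong₂; subst; subst₂; module ≡-Reasoning)

-- ℕ arithmetic is opened only inside this block, so that the integer operators of the
-- statement can be opened unqualified afterwards.
module _ where
  open import Algebra.Properties.CommutativeSemigroup as CSemigroup using ()
  open import Data.Nat.Base using (_+_; _*_; _≤_; _<_; z≤n; ≢-nonZero; ≢-nonZero⁻¹; nonTrivial⇒n>1)
  open import Data.Nat.Coprimality using (Coprime; coprime-factors)
  open import Data.Nat.Divisibility
    using (_∣_; divides; _∣?_; ∣-refl; ∣-trans; n∣m*n; 0∣⇒≡0; ∣1⇒≡1; >⇒∤; *-cancelˡ-∣)
  open import Data.Nat.ListAction using (product)
  open import Data.Nat.ListAction.Properties using (sum-++)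
  open import Data.Nat.Primality
    using (euclidsLemma; prime⇒irreducible; ¬prime[1]; prime⇒nonZero; prime⇒nonTrivial)
  open import Data.Nat.Primality.Factorisation using (factorise)
  open import Data.Nat.Properties
  open import Data.Nat.Tactic.RingSolver using (solve-∀)
  open import Data.List.Properties using (upTo-∷ʳ; map-++)
  open import Function.Bundles using (mk⇔)
  open import Relation.Nullary.Decidable using (yes; no; does; does-⇔; dec-true; dec-false; _×-dec_; _⊎-dec_)
  open import Relation.Nullary.Negation using (contradiction)
  open import Relation.Unary using (Decidable)
  open ≡-Reasoning

  Σ< : ℕ → (ℕ → ℕ) → ℕ
  Σ< zero    f = 0
  Σ< (suc N) f = Σ< N f + f N

  Σ<-cong : ∀ N {f g : ℕ → ℕ} → (∀ {m} → m < N → f m ≡ g m) → Σ< N f ≡ Σ< N g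
  Σ<-cong zero    f≗g = refl
  Σ<-cong (suc N) f≗g = cong₂ _+_ (Σ<-cong N (λ m<N → f≗g (m<n⇒m<1+n m<N))) (f≗g ≤-refl)

  Σ<-zero : ∀ N → Σ< N (λ _ → 0) ≡ 0
  Σ<-zero zero    = refl
  Σ<-zero (suc N) = trans (+-identityʳ _) (Σ<-zero N)

  Σ<-+ : ∀ N (f g : ℕ → ℕ) → Σ< N (λ m → f m + g m) ≡ Σ< N f + Σ< N g
  Σ<-+ zero    f g = refl
  Σ<-+ (suc N) f g = trans (cong (_+ (f N + g N)) (Σ<-+ N f g))
                           (CSemigroup.interchange +-commutativeSemigroup (Σ< N f) (Σ< N g) (f N) (g N))

  Σ<-vanishing : ∀ {K N} {f : ℕ → ℕ} → K ≤ N → (∀ {m} → K ≤ m → f m ≡ 0) → Σ< N f ≡ Σ< K f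
  Σ<-vanishing {N = zero} z≤n f≡0 = refl
  Σ<-vanishing {K} {suc N} {f} K≤1+N f≡0 with m≤n⇒m<n∨m≡n K≤1+N
  ... | inj₂ refl   = refl
  ... | inj₁ K<1+N = begin
    Σ< N f + f N  ≡⟨ cong (Σ< N f +_) (f≡0 K≤N) ⟩
    Σ< N f + 0    ≡⟨ +-identityʳ _ ⟩
    Σ< N f        ≡⟨ Σ<-vanishing K≤N f≡0 ⟩
    Σ< K f        ∎
    where
    K≤N : K ≤ N
    K≤N = ≤-pred K<1+N

  sum-upTo : ∀ (f : ℕ → ℕ) N → sum (map f (upTo N)) ≡ Σ< N f
  sum-upTo f zero    = refl
  sum-upTo f (suc N) = begin
    sum (map f (upTo (suc N)))        ≡⟨ cong (sum ∘ map f) (upTo-∷ʳ N) ⟨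
    sum (map f (upTo N ∷ʳ N))         ≡⟨ cong sum (map-++ f (upTo N) [ N ]) ⟩
    sum (map f (upTo N) ++ [ f N ])   ≡⟨ sum-++ (map f (upTo N)) [ f N ] ⟩
    sum (map f (upTo N)) + (f N + 0)  ≡⟨ cong₂ _+_ (sum-upTo f N) (+-identityʳ (f N)) ⟩
    Σ< N f + f N                      ∎

  𝟙 : Bool → ℕ
  𝟙 true  = 1
  𝟙 false = 0

  sum-filter : ∀ {P : ℕ → Set} (P? : Decidable P) (g : ℕ → ℕ) xs →
               sum (map g (filter P? xs)) ≡ sum (map (λ x → 𝟙 (does (P? x)) * g x) xs)
  sum-filter P? g []       = refl
  sum-filter P? g (x ∷ xs) with does (P? x)
  ... | true  = cong₂ _+_ (sym (+-identityʳ (g x))) (sum-filter P? g xs)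
  ... | false = sum-filter P? g xs

  𝟙[_∣_] : ℕ → ℕ → ℕ
  𝟙[ m ∣ k ] = 𝟙 (does (m ∣? k))

  divisorSum : (ℕ → ℕ) → ℕ → ℕ → ℕ
  divisorSum g N k = Σ< N (λ m → 𝟙[ m ∣ k ] * g m)

  sum-properDivisors : ∀ (g : ℕ → ℕ) {k} → k ≢ 0 → sum (map g (properDivisors k)) ≡ divisorSum g k k
  sum-properDivisors g {k} k≢0 = begin
    sum (map g (properDivisors k))
      ≡⟨ sum-filter (_∣? k) g (filter (1 ≤?_) (upTo k)) ⟩
    sum (map (λ m → 𝟙[ m ∣ k ] * g m) (filter (1 ≤?_) (upTo k)))
      ≡⟨ sum-filter (1 ≤?_) _ (upTo k) ⟩
    sum (map (λ m → 𝟙 (does (1 ≤? m)) * (𝟙[ m ∣ k ] * g m)) (upTo k))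
      ≡⟨ sum-upTo _ k ⟩
    Σ< k (λ m → 𝟙 (does (1 ≤? m)) * (𝟙[ m ∣ k ] * g m))
      ≡⟨ Σ<-cong k (λ {m} _ → positivity-test-redundant m) ⟩
    divisorSum g k k
      ∎
    where
    positivity-test-redundant : ∀ m → 𝟙 (does (1 ≤? m)) * (𝟙[ m ∣ k ] * g m) ≡ 𝟙[ m ∣ k ] * g m
    positivity-test-redundant zero    = sym (cong (λ b → 𝟙 b * g 0) (dec-false (0 ∣? k) (k≢0 ∘ 0∣⇒≡0)))
    positivity-test-redundant (suc m) = +-identityʳ _

  aFuel-irrelevant : ∀ f f′ {m} → m ≤ suc f → m ≤ suc f′ → aFuel f m ≡ aFuel f′ m
  aFuel-irrelevant zero    zero     _   _   = refl
  aFuel-irrelevant zero    (suc f′) {m} m≤1 _ with m ≤? 1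
  ... | yes _   = refl
  ... | no  m≰1 = contradiction m≤1 m≰1
  aFuel-irrelevant (suc f) zero     {m} _ m≤1 with m ≤? 1
  ... | yes _   = refl
  ... | no  m≰1 = contradiction m≤1 m≰1
  aFuel-irrelevant (suc f) (suc f′) {m} m≤2+f m≤2+f′ with m ≤? 1
  ... | yes _   = refl
  ... | no  m≰1 = cong suc (begin
    sum (map (aFuel f) (properDivisors m))   ≡⟨ sum-properDivisors (aFuel f) m≢0 ⟩
    divisorSum (aFuel f) m m                 ≡⟨ Σ<-cong m (λ {x} x<m → cong (𝟙[ x ∣ m ] *_)
                                                  (aFuel-irrelevant f f′ (below x<m m≤2+f) (below x<m m≤2+f′))) ⟩
    divisorSum (aFuel f′) m m                ≡⟨ sum-properDivisors (aFuel f′) m≢0 ⟨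
    sum (map (aFuel f′) (properDivisors m))  ∎)
    where
    m≢0 : m ≢ 0
    m≢0 refl = m≰1 z≤n
    below : ∀ {x g} → x < m → m ≤ suc (suc g) → x ≤ suc g
    below x<m m≤2+g = ≤-pred (≤-trans x<m m≤2+g)

  a-unfold : ∀ n → a n ≡ suc (divisorSum a n n)
  a-unfold zero            = refl
  a-unfold (suc zero)      = refl
  a-unfold n@(suc (suc k)) = cong suc (begin
    sum (map (aFuel (suc k)) (properDivisors n))  ≡⟨ sum-properDivisors (aFuel (suc k)) {n} (λ ()) ⟩
    divisorSum (aFuel (suc k)) n n                ≡⟨ Σ<-cong n (λ {m} m<n → cong (𝟙[ m ∣ n ] *_)
                                                       (aFuel-irrelevant (suc k) m {m} (<⇒≤ m<n) (n≤1+n m))) ⟩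
    divisorSum a n n                              ∎)

  divisorSum-self : ∀ k → 2 * a k ≡ suc (divisorSum a (suc k) k)
  divisorSum-self k = begin
    2 * a k                             ≡⟨ cong (_+ (a k + 0)) (a-unfold k) ⟩
    suc (divisorSum a k k + 1 * a k)    ≡⟨ cong (λ b → suc (divisorSum a k k + 𝟙 b * a k))
                                                (dec-true (k ∣? k) ∣-refl) ⟨
    suc (divisorSum a (suc k) k)        ∎

  divisorSum-beyond : ∀ (g : ℕ → ℕ) {N k} → k ≢ 0 → k < N → divisorSum g N k ≡ divisorSum g (suc k) k
  divisorSum-beyond g {k = k} k≢0 k<N = Σ<-vanishing k<N (λ {m} k<m →
    cong (λ b → 𝟙 b * g m) (dec-false (m ∣? k) (>⇒∤ {{≢-nonZero k≢0}} k<m)))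

  divisorSum-proper : ∀ {N k} → k ≢ 0 → k < N → 2 * a k ≡ suc (divisorSum a N k)
  divisorSum-proper {k = k} k≢0 k<N = trans (divisorSum-self k) (cong suc (sym (divisorSum-beyond a k≢0 k<N)))

  #divisible : ℕ → List ℕ → ℕ
  #divisible m ks = sum (map (λ k → 𝟙[ m ∣ k ]) ks)

  Σ<-#divisible : ∀ (g : ℕ → ℕ) N ks → Σ< N (λ m → #divisible m ks * g m) ≡ sum (map (divisorSum g N) ks)
  Σ<-#divisible g N []       = Σ<-zero N
  Σ<-#divisible g N (k ∷ ks) = begin
    Σ< N (λ m → (𝟙[ m ∣ k ] + #divisible m ks) * g m)
      ≡⟨ Σ<-cong N (λ {m} _ → *-distribʳ-+ (g m) 𝟙[ m ∣ k ] (#divisible m ks)) ⟩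
    Σ< N (λ m → 𝟙[ m ∣ k ] * g m + #divisible m ks * g m)
      ≡⟨ Σ<-+ N _ _ ⟩
    divisorSum g N k + Σ< N (λ m → #divisible m ks * g m)
      ≡⟨ cong (divisorSum g N k +_) (Σ<-#divisible g N ks) ⟩
    divisorSum g N k + sum (map (divisorSum g N) ks)
      ∎

  -- a n = 2 (Σ_{l ∈ ls} a l − Σ_{k ∈ ks} a k), stated without subtraction
  record Recurrence (n : ℕ) (ks ls : List ℕ) : Set where
    constructor recurrence
    field equation : a n + 2 * sum (map a ks) ≡ 2 * sum (map a ls)

  a-inclusion-exclusion : ∀ {n} ks ls →
    All (λ k → k ≢ 0 × k < n) ks → All (λ k → k ≢ 0 × k < n) ls → length ls ≡ suc (length ks) →
    (∀ {m} → m < n → #divisible m (n ∷ ks) ≡ #divisible m ls) →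
    Recurrence n ks ls
  a-inclusion-exclusion {n} ks ls ks-proper ls-proper |ls|≡1+|ks| same-count = recurrence (begin
    a n + 2 * sum (map a ks)                  ≡⟨ cong₂ _+_ (a-unfold n) (twice-sum ks-proper) ⟩
    suc (D n) + (sum (map D ks) + length ks)  ≡⟨ carry (D n) _ _ ⟩
    sum (map D (n ∷ ks)) + suc (length ks)    ≡⟨ cong₂ _+_ same-sum (sym |ls|≡1+|ks|) ⟩
    sum (map D ls) + length ls                ≡⟨ twice-sum ls-proper ⟨
    2 * sum (map a ls)                        ∎)
    where
    D : ℕ → ℕ
    D = divisorSum a n

    carry : ∀ x y z → suc x + (y + z) ≡ x + y + suc z
    carry x y z = trans (cong suc (sym (+-assoc x y z))) (sym (+-suc (x + y) z))

    twice-sum : ∀ {xs} → All (λ k → k ≢ 0 × k < n) xs → 2 * sum (map a xs) ≡ sum (map D xs) + length xs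
    twice-sum []                            = refl
    twice-sum {k ∷ xs} ((k≢0 , k<n) ∷ proper) = begin
      2 * (a k + sum (map a xs))                 ≡⟨ *-distribˡ-+ 2 (a k) _ ⟩
      2 * a k + 2 * sum (map a xs)               ≡⟨ cong₂ _+_ (divisorSum-proper k≢0 k<n) (twice-sum proper) ⟩
      suc (D k) + (sum (map D xs) + length xs)   ≡⟨ carry (D k) _ _ ⟩
      sum (map D (k ∷ xs)) + length (k ∷ xs)     ∎

    same-sum : sum (map D (n ∷ ks)) ≡ sum (map D ls)
    same-sum = begin
      sum (map D (n ∷ ks))                      ≡⟨ Σ<-#divisible a n (n ∷ ks) ⟨
      Σ< n (λ m → #divisible m (n ∷ ks) * a m)  ≡⟨ Σ<-cong n (λ {m} m<n → cong (_* a m) (same-count m<n)) ⟩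
      Σ< n (λ m → #divisible m ls * a m)        ≡⟨ Σ<-#divisible a n ls ⟩
      sum (map D ls)                            ∎

  inclusion-exclusion₂ : ∀ x y → sum (map 𝟙 ((x ∨ y) ∷ x ∧ y ∷ [])) ≡ sum (map 𝟙 (x ∷ y ∷ []))
  inclusion-exclusion₂ true  y = refl
  inclusion-exclusion₂ false y = refl

  inclusion-exclusion₃ : ∀ x y z → sum (map 𝟙 ((x ∨ y ∨ z) ∷ x ∧ y ∷ x ∧ z ∷ y ∧ z ∷ []))
                                  ≡ sum (map 𝟙 (x ∷ y ∷ z ∷ x ∧ y ∧ z ∷ []))
  inclusion-exclusion₃ true  y     z = refl
  inclusion-exclusion₃ false true  z = refl
  inclusion-exclusion₃ false false z = refl

  ∣-prime⇒≡ : ∀ {s p} → Prime s → Prime p → s ∣ p → s ≡ p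
  ∣-prime⇒≡ s-prime p-prime s∣p with prime⇒irreducible p-prime s∣p
  ... | inj₁ refl = contradiction s-prime ¬prime[1]
  ... | inj₂ s≡p  = s≡p

  ∣-prime-power⇒≡ : ∀ {s p} i → Prime s → Prime p → s ∣ p ^ i → s ≡ p
  ∣-prime-power⇒≡ zero s-prime p-prime s∣1 = contradiction (subst Prime (∣1⇒≡1 s∣1) s-prime) ¬prime[1]
  ∣-prime-power⇒≡ {p = p} (suc i) s-prime p-prime s∣p^1+i with euclidsLemma p (p ^ i) s-prime s∣p^1+i
  ... | inj₁ s∣p   = ∣-prime⇒≡ s-prime p-prime s∣p
  ... | inj₂ s∣p^i = ∣-prime-power⇒≡ i s-prime p-prime s∣p^i

  distinct-primes-coprime : ∀ {p q} → Prime p → Prime q → p ≢ q → Coprime p q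
  distinct-primes-coprime p-prime q-prime p≢q (d∣p , d∣q) with prime⇒irreducible p-prime d∣p
  ... | inj₁ d≡1 = d≡1
  ... | inj₂ refl = contradiction (∣-prime⇒≡ p-prime q-prime d∣q) p≢q

  ∣-proper⇒∣-cofactor : ∀ {m n} → n ≢ 0 → m ∣ n → m ≢ n →
                         ∃[ s ] Prime s × s ∣ n × (∀ {X} → n ≡ s * X → m ∣ X)
  ∣-proper⇒∣-cofactor {m} {n} n≢0 (divides t n≡tm) m≢n with factorise t {{≢-nonZero t≢0}}
    where
    t≢0 : t ≢ 0
    t≢0 refl = n≢0 n≡tm
  ... | record { factors = [] ; isFactorisation = t≡1 } =
    contradiction (sym (trans n≡tm (trans (cong (_* m) t≡1) (+-identityʳ m)))) m≢n
  ... | record { factors = s ∷ ss ; isFactorisation = t≡s*ss ; factorsPrime = s-prime ∷ _ } =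
    s , s-prime , ∣-trans (n∣m*n m) ms∣n , cancel
    where
    regroup : ∀ x y z → x * y * z ≡ y * (z * x)
    regroup = solve-∀
    ms∣n : m * s ∣ n
    ms∣n = divides (product ss) (trans n≡tm (trans (cong (_* m) t≡s*ss) (regroup s (product ss) m)))
    cancel : ∀ {X} → n ≡ s * X → m ∣ X
    cancel n≡sX = *-cancelˡ-∣ s {{prime⇒nonZero s-prime}} (subst₂ _∣_ (*-comm m s) n≡sX ms∣n)

  does-∣-meet : ∀ {x y o X Y} → Coprime x y → X ≡ x * o → Y ≡ y * o →
                ∀ m → does (m ∣? o) ≡ does (m ∣? X) ∧ does (m ∣? Y)
  does-∣-meet {x} {y} {o} {X} {Y} coprime X≡xo Y≡yo m =
    does-⇔ (mk⇔ to from) (m ∣? o) (m ∣? X ×-dec m ∣? Y)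
    where
    to : m ∣ o → m ∣ X × m ∣ Y
    to m∣o = ∣-trans m∣o (divides x X≡xo) , ∣-trans m∣o (divides y Y≡yo)
    from : m ∣ X × m ∣ Y → m ∣ o
    from (m∣X , m∣Y) = coprime-factors coprime (subst (m ∣_) X≡xo m∣X , subst (m ∣_) Y≡yo m∣Y)

  <-prime-multiple : ∀ {s X n} → Prime s → X ≢ 0 → n ≡ s * X → X < n
  <-prime-multiple {s} {X} s-prime X≢0 n≡sX =
    subst (X <_) (trans (*-comm X s) (sym n≡sX))
          (m<m*n X s {{≢-nonZero X≢0}} (nonTrivial⇒n>1 s {{prime⇒nonTrivial s-prime}}))

  prime⇒≢0 : ∀ {p} → Prime p → p ≢ 0
  prime⇒≢0 {p} p-prime = ≢-nonZero⁻¹ p {{prime⇒nonZero p-prime}}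

  ^≢0 : ∀ {p} i → p ≢ 0 → p ^ i ≢ 0
  ^≢0 {p} i p≢0 = p≢0 ∘ m^n≡0⇒m≡0 p i

  *≢0 : ∀ {x y} → x ≢ 0 → y ≢ 0 → x * y ≢ 0
  *≢0 {x} x≢0 y≢0 = [ x≢0 , y≢0 ]′ ∘ m*n≡0⇒m≡0∨n≡0 x

  module _ {p} (p-prime : Prime p) where

    p^-maximal : ∀ c {m} → m ∣ p ^ suc c → m ≢ p ^ suc c → m ∣ p ^ c
    p^-maximal c m∣n m≢n with ∣-proper⇒∣-cofactor (^≢0 (suc c) (prime⇒≢0 p-prime)) m∣n m≢n
    ... | s , s-prime , s∣n , m∣n/s with ∣-prime-power⇒≡ (suc c) s-prime p-prime s∣n
    ...   | refl = m∣n/s refl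

    prime-power-recurrence : ∀ c → Recurrence (p ^ suc c) [] (p ^ c ∷ [])
    prime-power-recurrence c =
      a-inclusion-exclusion [] (p ^ c ∷ []) [] ((p^c≢0 , <-prime-multiple p-prime p^c≢0 refl) ∷ [])
                            refl same-count
      where
      p^c≢0 : p ^ c ≢ 0
      p^c≢0 = ^≢0 c (prime⇒≢0 p-prime)

      same-count : ∀ {m} → m < p ^ suc c → #divisible m (p ^ suc c ∷ []) ≡ #divisible m (p ^ c ∷ [])
      same-count {m} m<n = cong (λ b → 𝟙 b + 0)
        (does-⇔ (mk⇔ (λ m∣n → p^-maximal c m∣n (<⇒≢ m<n)) (λ m∣A → ∣-trans m∣A (n∣m*n p)))
                (m ∣? p ^ suc c) (m ∣? p ^ c))

    module _ {q} (q-prime : Prime q) (p≢q : p ≢ q) where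

      pq : ℕ → ℕ → ℕ
      pq i j = p ^ i * q ^ j

      pq-suc₁ : ∀ i j → pq (suc i) j ≡ p * pq i j
      pq-suc₁ i j = *-assoc p (p ^ i) (q ^ j)

      pq-suc₂ : ∀ i j → pq i (suc j) ≡ q * pq i j
      pq-suc₂ i j = CSemigroup.x∙yz≈y∙xz *-commutativeSemigroup (p ^ i) q (q ^ j)

      pq≢0 : ∀ i j → pq i j ≢ 0
      pq≢0 i j = *≢0 (^≢0 i (prime⇒≢0 p-prime)) (^≢0 j (prime⇒≢0 q-prime))

      pq-prime-factor : ∀ {s} i j → Prime s → s ∣ pq i j → s ≡ p ⊎ s ≡ q
      pq-prime-factor i j s-prime s∣pq with euclidsLemma (p ^ i) (q ^ j) s-prime s∣pq
      ... | inj₁ s∣p^i = inj₁ (∣-prime-power⇒≡ i s-prime p-prime s∣p^i)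
      ... | inj₂ s∣q^j = inj₂ (∣-prime-power⇒≡ j s-prime q-prime s∣q^j)

      pq-maximal : ∀ c d {m} → m ∣ pq (suc c) (suc d) → m ≢ pq (suc c) (suc d) →
                   m ∣ pq c (suc d) ⊎ m ∣ pq (suc c) d
      pq-maximal c d m∣n m≢n with ∣-proper⇒∣-cofactor (pq≢0 (suc c) (suc d)) m∣n m≢n
      ... | s , s-prime , s∣n , m∣n/s with pq-prime-factor (suc c) (suc d) s-prime s∣n
      ...   | inj₁ refl = inj₁ (m∣n/s (pq-suc₁ c (suc d)))
      ...   | inj₂ refl = inj₂ (m∣n/s (pq-suc₂ (suc c) d))

      two-prime-powers-recurrence : ∀ c d →
        Recurrence (pq (suc c) (suc d)) (pq c d ∷ []) (pq c (suc d) ∷ pq (suc c) d ∷ [])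
      two-prime-powers-recurrence c d =
        a-inclusion-exclusion _ _
          ((pq≢0 c d , W<n) ∷ [])
          ((pq≢0 c (suc d) , A<n) ∷ (pq≢0 (suc c) d , B<n) ∷ [])
          refl same-count
        where
        n A B W : ℕ
        n = pq (suc c) (suc d)
        A = pq c (suc d)
        B = pq (suc c) d
        W = pq c d

        A<n : A < n
        A<n = <-prime-multiple p-prime (pq≢0 c (suc d)) (pq-suc₁ c (suc d))
        B<n : B < n
        B<n = <-prime-multiple q-prime (pq≢0 (suc c) d) (pq-suc₂ (suc c) d)
        W<n : W < n
        W<n = <-trans (<-prime-multiple p-prime (pq≢0 c d) (pq-suc₁ c d)) B<n

        does-n : ∀ {m} → m < n → does (m ∣? n) ≡ does (m ∣? A) ∨ does (m ∣? B)
        does-n {m} m<n = does-⇔ (mk⇔ (λ m∣n → pq-maximal c d m∣n (<⇒≢ m<n))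
                                     [ (λ m∣A → ∣-trans m∣A (divides p (pq-suc₁ c (suc d))))
                                     , (λ m∣B → ∣-trans m∣B (divides q (pq-suc₂ (suc c) d))) ]′)
                                (m ∣? n) (m ∣? A ⊎-dec m ∣? B)

        does-W : ∀ m → does (m ∣? W) ≡ does (m ∣? A) ∧ does (m ∣? B)
        does-W = does-∣-meet (distinct-primes-coprime q-prime p-prime (p≢q ∘ sym)) (pq-suc₂ c d) (pq-suc₁ c d)

        same-count : ∀ {m} → m < n → #divisible m (n ∷ W ∷ []) ≡ #divisible m (A ∷ B ∷ [])
        same-count {m} m<n rewrite does-n m<n | does-W m = inclusion-exclusion₂ (does (m ∣? A)) (does (m ∣? B))

      module _ {r} (r-prime : Prime r) (p≢r : p ≢ r) (q≢r : q ≢ r) where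

        pqr : ℕ → ℕ → ℕ → ℕ
        pqr i j k = pq i j * r ^ k

        pqr-suc₁ : ∀ i j k → pqr (suc i) j k ≡ p * pqr i j k
        pqr-suc₁ i j k = trans (cong (_* r ^ k) (pq-suc₁ i j)) (*-assoc p (pq i j) (r ^ k))

        pqr-suc₂ : ∀ i j k → pqr i (suc j) k ≡ q * pqr i j k
        pqr-suc₂ i j k = trans (cong (_* r ^ k) (pq-suc₂ i j)) (*-assoc q (pq i j) (r ^ k))

        pqr-suc₃ : ∀ i j k → pqr i j (suc k) ≡ r * pqr i j k
        pqr-suc₃ i j k = CSemigroup.x∙yz≈y∙xz *-commutativeSemigroup (pq i j) r (r ^ k)

        pqr≢0 : ∀ i j k → pqr i j k ≢ 0
        pqr≢0 i j k = *≢0 (pq≢0 i j) (^≢0 k (prime⇒≢0 r-prime))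

        pqr-prime-factor : ∀ {s} i j k → Prime s → s ∣ pqr i j k → s ≡ p ⊎ s ≡ q ⊎ s ≡ r
        pqr-prime-factor i j k s-prime s∣pqr with euclidsLemma (pq i j) (r ^ k) s-prime s∣pqr
        ... | inj₁ s∣pq  = [ inj₁ , inj₂ ∘ inj₁ ]′ (pq-prime-factor i j s-prime s∣pq)
        ... | inj₂ s∣r^k = inj₂ (inj₂ (∣-prime-power⇒≡ k s-prime r-prime s∣r^k))

        pqr-maximal : ∀ c d e {m} → m ∣ pqr (suc c) (suc d) (suc e) → m ≢ pqr (suc c) (suc d) (suc e) →
                      m ∣ pqr c (suc d) (suc e) ⊎ m ∣ pqr (suc c) d (suc e) ⊎ m ∣ pqr (suc c) (suc d) e
        pqr-maximal c d e m∣n m≢n with ∣-proper⇒∣-cofactor (pqr≢0 (suc c) (suc d) (suc e)) m∣n m≢n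
        ... | s , s-prime , s∣n , m∣n/s with pqr-prime-factor (suc c) (suc d) (suc e) s-prime s∣n
        ...   | inj₁ refl        = inj₁ (m∣n/s (pqr-suc₁ c (suc d) (suc e)))
        ...   | inj₂ (inj₁ refl) = inj₂ (inj₁ (m∣n/s (pqr-suc₂ (suc c) d (suc e))))
        ...   | inj₂ (inj₂ refl) = inj₂ (inj₂ (m∣n/s (pqr-suc₃ (suc c) (suc d) e)))

        three-prime-powers-recurrence : ∀ c d e →
          Recurrence (pqr (suc c) (suc d) (suc e))
                     (pqr c d (suc e) ∷ pqr c (suc d) e ∷ pqr (suc c) d e ∷ [])
                     (pqr c (suc d) (suc e) ∷ pqr (suc c) d (suc e) ∷ pqr (suc c) (suc d) e ∷ pqr c d e ∷ [])
        three-prime-powers-recurrence c d e =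
          a-inclusion-exclusion _ _
            ((pqr≢0 c d (suc e) , ab<n) ∷ (pqr≢0 c (suc d) e , ac<n) ∷ (pqr≢0 (suc c) d e , bc<n) ∷ [])
            ((pqr≢0 c (suc d) (suc e) , A<n) ∷ (pqr≢0 (suc c) d (suc e) , B<n) ∷ (pqr≢0 (suc c) (suc d) e , C<n)
              ∷ (pqr≢0 c d e , W<n) ∷ [])
            refl same-count
          where
          n A B C ab ac bc W : ℕ
          n  = pqr (suc c) (suc d) (suc e)
          A  = pqr c (suc d) (suc e)
          B  = pqr (suc c) d (suc e)
          C  = pqr (suc c) (suc d) e
          ab = pqr c d (suc e)
          ac = pqr c (suc d) e
          bc = pqr (suc c) d e
          W  = pqr c d e

          A<n : A < n
          A<n = <-prime-multiple p-prime (pqr≢0 c (suc d) (suc e)) (pqr-suc₁ c (suc d) (suc e))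
          B<n : B < n
          B<n = <-prime-multiple q-prime (pqr≢0 (suc c) d (suc e)) (pqr-suc₂ (suc c) d (suc e))
          C<n : C < n
          C<n = <-prime-multiple r-prime (pqr≢0 (suc c) (suc d) e) (pqr-suc₃ (suc c) (suc d) e)
          ab<n : ab < n
          ab<n = <-trans (<-prime-multiple p-prime (pqr≢0 c d (suc e)) (pqr-suc₁ c d (suc e))) B<n
          ac<n : ac < n
          ac<n = <-trans (<-prime-multiple p-prime (pqr≢0 c (suc d) e) (pqr-suc₁ c (suc d) e)) C<n
          bc<n : bc < n
          bc<n = <-trans (<-prime-multiple q-prime (pqr≢0 (suc c) d e) (pqr-suc₂ (suc c) d e)) C<n
          W<n : W < n
          W<n = <-trans (<-prime-multiple p-prime (pqr≢0 c d e) (pqr-suc₁ c d e)) bc<n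

          coprime : ∀ {x y} → Prime x → Prime y → y ≢ x → Coprime x y
          coprime x-prime y-prime y≢x = distinct-primes-coprime x-prime y-prime (y≢x ∘ sym)

          does-n : ∀ {m} → m < n → does (m ∣? n) ≡ does (m ∣? A) ∨ does (m ∣? B) ∨ does (m ∣? C)
          does-n {m} m<n = does-⇔ (mk⇔ (λ m∣n → pqr-maximal c d e m∣n (<⇒≢ m<n))
                                       [ (λ m∣A → ∣-trans m∣A (divides p (pqr-suc₁ c (suc d) (suc e))))
                                       , [ (λ m∣B → ∣-trans m∣B (divides q (pqr-suc₂ (suc c) d (suc e))))
                                         , (λ m∣C → ∣-trans m∣C (divides r (pqr-suc₃ (suc c) (suc d) e))) ]′ ]′)
                                  (m ∣? n) (m ∣? A ⊎-dec m ∣? B ⊎-dec m ∣? C)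

          does-ab : ∀ m → does (m ∣? ab) ≡ does (m ∣? A) ∧ does (m ∣? B)
          does-ab = does-∣-meet (coprime q-prime p-prime p≢q) (pqr-suc₂ c d (suc e)) (pqr-suc₁ c d (suc e))

          does-ac : ∀ m → does (m ∣? ac) ≡ does (m ∣? A) ∧ does (m ∣? C)
          does-ac = does-∣-meet (coprime r-prime p-prime p≢r) (pqr-suc₃ c (suc d) e) (pqr-suc₁ c (suc d) e)

          does-bc : ∀ m → does (m ∣? bc) ≡ does (m ∣? B) ∧ does (m ∣? C)
          does-bc = does-∣-meet (coprime r-prime q-prime q≢r) (pqr-suc₃ (suc c) d e) (pqr-suc₂ (suc c) d e)

          does-W : ∀ m → does (m ∣? W) ≡ does (m ∣? A) ∧ does (m ∣? B) ∧ does (m ∣? C)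
          does-W m = begin
            does (m ∣? W)
              ≡⟨ meet ⟩
            does (m ∣? ab) ∧ does (m ∣? ac)
              ≡⟨ cong₂ _∧_ (does-ab m) (does-ac m) ⟩
            (does (m ∣? A) ∧ does (m ∣? B)) ∧ (does (m ∣? A) ∧ does (m ∣? C))
              ≡⟨ ∧-share (does (m ∣? A)) _ _ ⟩
            does (m ∣? A) ∧ does (m ∣? B) ∧ does (m ∣? C)
              ∎
            where
            meet = does-∣-meet (coprime r-prime q-prime q≢r) (pqr-suc₃ c d e) (pqr-suc₂ c d e) m
            ∧-share : ∀ x y z → (x ∧ y) ∧ (x ∧ z) ≡ x ∧ y ∧ z
            ∧-share true  y z = refl
            ∧-share false y z = refl

          same-count : ∀ {m} → m < n →
                       #divisible m (n ∷ ab ∷ ac ∷ bc ∷ []) ≡ #divisible m (A ∷ B ∷ C ∷ W ∷ [])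
          same-count {m} m<n rewrite does-n m<n | does-ab m | does-ac m | does-bc m | does-W m =
            inclusion-exclusion₃ (does (m ∣? A)) (does (m ∣? B)) (does (m ∣? C))

open import Data.Integer.Base using (ℤ; +_; _+_; _-_; _*_)
open import Data.Integer.Properties using (pos-*)
open import Data.Integer.Tactic.RingSolver using (solve-∀)

Recurrence⇒ℤ : ∀ {n ks ls w} → Recurrence n ks ls → + sum (map a ls) - + sum (map a ks) ≡ w →
               + a n ≡ + 2 * w
Recurrence⇒ℤ {n} {ks} {ls} (recurrence equation) refl = begin
  + a n                          ≡⟨ cancel (+ a n) (+ y) ⟩
  + a n + + 2 * + y - + 2 * + y  ≡⟨ cong (λ t → t - + 2 * + y) lifted ⟩
  + 2 * + x - + 2 * + y          ≡⟨ factor (+ x) (+ y) ⟩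
  + 2 * (+ x - + y)              ∎
  where
  open ≡-Reasoning
  x y : ℕ
  x = sum (map a ls)
  y = sum (map a ks)
  cancel : ∀ u v → u ≡ u + + 2 * v - + 2 * v
  cancel = solve-∀
  factor : ∀ u v → + 2 * u - + 2 * v ≡ + 2 * (u - v)
  factor = solve-∀
  lifted : + a n + + 2 * + y ≡ + 2 * + x
  lifted = trans (cong (λ t → + a n + t) (sym (pos-* 2 y))) (trans (cong +_ equation) (pos-* 2 x))

recurrence₁ : ∀ {n A} → Recurrence n [] (A ∷ []) → + a n ≡ + 2 * + a A
recurrence₁ {A = A} rec = Recurrence⇒ℤ rec (regroup (+ a A))
  where
  regroup : ∀ x → (x + + 0) - + 0 ≡ x
  regroup = solve-∀

recurrence₂ : ∀ {n A B W} → Recurrence n (W ∷ []) (A ∷ B ∷ []) → + a n ≡ + 2 * (+ a A + + a B - + a W)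
recurrence₂ {A = A} {B} {W} rec = Recurrence⇒ℤ rec (regroup (+ a A) (+ a B) (+ a W))
  where
  regroup : ∀ x y w → (x + (y + + 0)) - (w + + 0) ≡ x + y - w
  regroup = solve-∀

recurrence₃ : ∀ {n A B C ab ac bc W} → Recurrence n (ab ∷ ac ∷ bc ∷ []) (A ∷ B ∷ C ∷ W ∷ []) →
              + a n ≡ + 2 * (+ a A + + a B + + a C - + a bc - + a ac - + a ab + + a W)
recurrence₃ {A = A} {B} {C} {ab} {ac} {bc} {W} rec =
  Recurrence⇒ℤ rec (regroup (+ a A) (+ a B) (+ a C) (+ a W) (+ a ab) (+ a ac) (+ a bc))
  where
  regroup : ∀ x y z w u v t → (x + (y + (z + (w + + 0)))) - (u + (v + (t + + 0))) ≡ x + y + z - t - v - u + w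
  regroup = solve-∀

theorem4 : (p q r c d e : ℕ) → Prime p → Prime q → Prime r →
           p ≢ q → p ≢ r → q ≢ r →
           .{{_ : NonZero c}} → .{{_ : NonZero d}} → .{{_ : NonZero e}} →
           (+ a (p ^ c) ≡ + 2 * + a (p ^ (c ∸ 1)))
           × (+ a (p ^ c · q ^ d)
                ≡ + 2 * (+ a (p ^ (c ∸ 1) · q ^ d) + + a (p ^ c · q ^ (d ∸ 1))
                         - + a (p ^ (c ∸ 1) · q ^ (d ∸ 1))))
           × (+ a (p ^ c · q ^ d · r ^ e)
                ≡ + 2 * (+ a (p ^ (c ∸ 1) · q ^ d · r ^ e)
                         + + a (p ^ c · q ^ (d ∸ 1) · r ^ e)
                         + + a (p ^ c · q ^ d · r ^ (e ∸ 1))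
                         - + a (p ^ c · q ^ (d ∸ 1) · r ^ (e ∸ 1))
                         - + a (p ^ (c ∸ 1) · q ^ d · r ^ (e ∸ 1))
                         - + a (p ^ (c ∸ 1) · q ^ (d ∸ 1) · r ^ e)
                         + + a (p ^ (c ∸ 1) · q ^ (d ∸ 1) · r ^ (e ∸ 1))))
theorem4 p q r (suc c) (suc d) (suc e) p-prime q-prime r-prime p≢q p≢r q≢r =
    recurrence₁ (prime-power-recurrence p-prime c)
  , recurrence₂ (two-prime-powers-recurrence p-prime q-prime p≢q c d)
  , recurrence₃ (three-prime-powers-recurrence p-prime q-prime p≢q r-prime p≢r q≢r c d e)
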